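{- Let $n\geq 4$ and let $R_n$ be the tournament on vertices $v_1,\dots,v_n$ in which, for $i<j$, $v_i$ dominates $v_j$, except that $v_n$ dominates $v_1$. Then $R_n$ is $(n-1)$-skew-spectrally monomorphic but not $(n-1)$-spectrally monomorphic.
   Context: An $n$-tournament is a digraph on $n$ vertices in which every pair of distinct vertices is joined by exactly one arc; if the arc goes from $u$ to $v$, $u$ dominates $v$. Its adjacency matrix $A=(a_{ij})$ (w.r.t. an ordering $v_1,\dots,v_n$) has $a_{ij}=1$ if $v_i$ dominates $v_j$ and $0$ otherwise; its skew-adjacency matrix is $S=A-A^{\top}$. A square matrix is $k$-spectrally monomorphic if all its $k\times k$ principal submatrices have the same characteristic polynomial $\det(zI-M)$. A tournament is $k$-spectrally monomorphic if its adjacency matrix is $k$-spectrally monomorphic, and $k$-skew-spectrally monomorphic if its skew-adjacency matrix is $k$-spectrally monomorphic. -}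

module Defs where

open import Data.Nat using (ℕ; zero; suc; _<ᵇ_; _≡ᵇ_)
open import Data.Bool using (Bool; true; false; if_then_else_; _∧_; not)
open import Data.Integer using (ℤ; +_; -_) renaming (_+_ to _+ℤ_; _*_ to _*ℤ_)
open import Data.List using (List; []; _∷_)
open import Data.Fin using (Fin; zero; suc; toℕ; punchIn) renaming (_<_ to _<ᶠ_)
open import Relation.Binary.PropositionalEquality using (_≡_)

-- Univariate polynomials over ℤ in the indeterminate z,
-- as coefficient lists (constant term first).

Poly : Set
Poly = List ℤ

coeff : Poly → ℕ → ℤ
coeff []       _       = + 0
coeff (a ∷ p)  zero    = a
coeff (a ∷ p)  (suc k) = coeff p k

infix 4 _≈P_
_≈P_ : Poly → Poly → Set
p ≈P q = ∀ k → coeff p k ≡ coeff q k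

infixl 6 _+P_
_+P_ : Poly → Poly → Poly
[]      +P q       = q
(a ∷ p) +P []      = a ∷ p
(a ∷ p) +P (b ∷ q) = (a +ℤ b) ∷ (p +P q)

negP : Poly → Poly
negP []      = []
negP (a ∷ p) = (- a) ∷ negP p

scaleP : ℤ → Poly → Poly
scaleP c []      = []
scaleP c (a ∷ p) = (c *ℤ a) ∷ scaleP c p

infixl 7 _*P_
_*P_ : Poly → Poly → Poly
[]      *P q = []
(a ∷ p) *P q = scaleP a q +P (+ 0 ∷ (p *P q))

constP : ℤ → Poly
constP c = c ∷ []

zP : Poly
zP = + 0 ∷ + 1 ∷ []

Matrix : Set → ℕ → Set
Matrix A n = Fin n → Fin n → A

signP : ℕ → Poly → Poly
signP zero          p = p
signP (suc zero)    p = negP p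
signP (suc (suc j)) p = signP j p

minor : ∀ {A : Set} {k} → Matrix A (suc k) → Fin (suc k) → Matrix A k
minor M j r c = M (suc r) (punchIn j c)

sumFin : ∀ {k} → (Fin k → Poly) → Poly
sumFin {zero}  f = []
sumFin {suc k} f = f zero +P sumFin (λ i → f (suc i))

det : ∀ {n} → Matrix Poly n → Poly
det {zero}  M = constP (+ 1)
det {suc k} M = sumFin (λ j → signP (toℕ j) (M zero j *P det (minor M j)))

charPoly : ∀ {n} → Matrix ℤ n → Poly
charPoly {n} M = det (λ i j → (if toℕ i ≡ᵇ toℕ j then zP else []) +P negP (constP (M i j)))

StrictlyIncreasing : ∀ {k n} → (Fin k → Fin n) → Set
StrictlyIncreasing σ = ∀ i j → i <ᶠ j → σ i <ᶠ σ j

principalSub : ∀ {A : Set} {k n} → Matrix A n → (Fin k → Fin n) → Matrix A k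
principalSub M σ i j = M (σ i) (σ j)

SpectrallyMonomorphic : ∀ {n} → ℕ → Matrix ℤ n → Set
SpectrallyMonomorphic {n} k M =
  ∀ (σ τ : Fin k → Fin n) → StrictlyIncreasing σ → StrictlyIncreasing τ →
  charPoly (principalSub M σ) ≈P charPoly (principalSub M τ)

boolℤ : Bool → ℤ
boolℤ true  = + 1
boolℤ false = + 0

adjacency : ∀ {n} → (Fin n → Fin n → Bool) → Matrix ℤ n
adjacency T i j = boolℤ (T i j)

skewAdjacency : ∀ {n} → (Fin n → Fin n → Bool) → Matrix ℤ n
skewAdjacency T i j = boolℤ (T i j) +ℤ (- boolℤ (T j i))

-- R_n on vertices v_1..v_n (here indices 0..n-1):
-- v_i → v_j for i < j, except that v_n → v_1 instead of v_1 → v_n.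
R : (n : ℕ) → Fin n → Fin n → Bool
R n i j =
  if toℕ i <ᵇ toℕ j
  then not ((toℕ i ≡ᵇ 0) ∧ (suc (toℕ j) ≡ᵇ n))
  else ((toℕ j ≡ᵇ 0) ∧ (suc (toℕ i) ≡ᵇ n) ∧ not (toℕ i ≡ᵇ toℕ j))

-- Omitting v_1 or v_n leaves the transitive
-- tournament T_{n−1}; omitting any other vertex leaves R_{n−1}. For m ≥ 3, reversing every arc at the last
-- vertex of R_m turns it into a transitive tournament, and on skew-adjacency matrices this reversal is
-- conjugation by a diagonal ±1 matrix; relabelling a transitive tournament as T_m is conjugation by a
-- product of adjacent transpositions. Both conjugations preserve det(zI − S), so all the principal
-- (n−1)-submatrices of S(R_n) share the characteristic polynomial of S(T_{n−1}).
-- For the adjacency matrix compare constant terms det(−A): without v_1 the vertex v_2 has in-degree 0,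
-- so −A has a zero column; without v_2 one gets R_{n−1}, whose first column has a single nonzero entry
-- (only the last vertex dominates v_1) with a triangular complementary minor, so det(−A) = ±1.

module Submission where

open import Defs hiding (det)
open import Algebra.Bundles using (CommutativeRing; CommutativeSemigroup)
open import Level using (0ℓ)
open import Data.Nat using (ℕ; zero; suc; _≤_; _<_; _<ᵇ_; _≡ᵇ_; _∸_; s≤s; z≤n; z<s; s<s⁻¹)
open import Data.Fin as Fin using (Fin; zero; suc; toℕ; punchIn; fromℕ; inject₁)
open import Relation.Binary.PropositionalEquality as ≡ using (_≡_)

swap : ℕ → ∀ {n} → Fin n → Fin n
swap zero    {suc (suc n)} zero          = suc zero
swap zero    {suc (suc n)} (suc zero)    = zero
swap zero    {suc (suc n)} (suc (suc i)) = suc (suc i)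
swap zero    {suc zero}    zero          = zero
swap (suc r) {suc n}       zero          = zero
swap (suc r) {suc n}       (suc i)       = suc (swap r i)

swap-involutive : ∀ r {n} (i : Fin n) → swap r (swap r i) ≡ i
swap-involutive zero    {suc (suc n)} zero          = ≡.refl
swap-involutive zero    {suc (suc n)} (suc zero)    = ≡.refl
swap-involutive zero    {suc (suc n)} (suc (suc i)) = ≡.refl
swap-involutive zero    {suc zero}    zero          = ≡.refl
swap-involutive (suc r) {suc n}       zero          = ≡.refl
swap-involutive (suc r) {suc n}       (suc i)       = ≡.cong suc (swap-involutive r i)

module Determinant {ℓ} (CR : CommutativeRing 0ℓ ℓ) where

  open import Data.Vec.Functional using (transpose)
  open CommutativeRing CR renaming (Carrier to C) hiding (zero)
  open import Algebra.Properties.Ring ring using (-1*x≈-x; -‿distribʳ-*; -‿involutive; -‿+-comm; -0#≈0#)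
  open import Algebra.Properties.CommutativeSemigroup *-commutativeSemigroup using (x∙yz≈y∙xz; interchange)
  open import Algebra.Properties.CommutativeSemigroup +-commutativeSemigroup using () renaming (x∙yz≈y∙xz to x+yz≈y+xz)
  open import Algebra.Properties.Semiring.Sum semiring public using (sum; sum-cong-≗)
  open import Algebra.Properties.Semiring.Sum semiring
    using (sum-cong-≋; sum-replicate-zero; sum-init-last; ∑-comm; *-distribˡ-sum)
  open import Algebra.Properties.CommutativeMonoid.Sum *-commutativeMonoid public using () renaming (sum to product)
  open import Algebra.Properties.CommutativeMonoid.Sum *-commutativeMonoid
    using () renaming (sum-cong-≋ to product-cong; sum-replicate-zero to product-replicate-one;
                       ∑-distrib-+ to product-distrib-*)
  open import Relation.Binary.Reasoning.Setoid setoid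

  signed : ℕ → C → C
  signed zero          x = x
  signed (suc zero)    x = - x
  signed (suc (suc j)) x = signed j x

  det : ∀ {n} → Matrix C n → C
  det {zero}  M = 1#
  det {suc k} M = sum (λ j → signed (toℕ j) (M zero j * det (minor M j)))

  firstColumnMinor : ∀ {k} → Matrix C (suc k) → Fin (suc k) → Matrix C k
  firstColumnMinor M i r c = M (punchIn i r) (suc c)

  sum-zero : ∀ {n} (f : Fin n → C) → (∀ i → f i ≈ 0#) → sum f ≈ 0#
  sum-zero {n} f f≈0 = trans (sum-cong-≋ f≈0) (sum-replicate-zero n)

  sum-head : ∀ {n} (f : Fin (suc n) → C) → (∀ i → f (suc i) ≈ 0#) → sum f ≈ f zero
  sum-head f tail≈0 = trans (+-congˡ (sum-zero _ tail≈0)) (+-identityʳ _)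

  sum-last : ∀ {n} (f : Fin (suc n) → C) → (∀ i → f (inject₁ i) ≈ 0#) → sum f ≈ f (fromℕ n)
  sum-last f init≈0 = trans (sum-init-last f) (trans (+-congʳ (sum-zero _ init≈0)) (+-identityˡ _))

  -‿sum : ∀ {n} (f : Fin n → C) → - sum f ≈ sum (λ i → - f i)
  -‿sum f = begin
    - sum f               ≈⟨ -1*x≈-x (sum f) ⟨
    - 1# * sum f          ≈⟨ *-distribˡ-sum (- 1#) f ⟩
    sum (λ i → - 1# * f i) ≈⟨ sum-cong-≋ (λ i → -1*x≈-x (f i)) ⟩
    sum (λ i → - f i)     ∎

  signed-unfold : ∀ j x → signed j x ≈ signed j 1# * x
  signed-unfold zero          x = sym (*-identityˡ x)
  signed-unfold (suc zero)    x = sym (-1*x≈-x x)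
  signed-unfold (suc (suc j)) x = signed-unfold j x

  signed-cong : ∀ j {x y} → x ≈ y → signed j x ≈ signed j y
  signed-cong j {x} {y} x≈y = trans (signed-unfold j x) (trans (*-congˡ x≈y) (sym (signed-unfold j y)))

  signed-suc : ∀ j x → signed (suc j) x ≈ - signed j x
  signed-suc zero          x = refl
  signed-suc (suc zero)    x = sym (-‿involutive x)
  signed-suc (suc (suc j)) x = signed-suc j x

  signed-*ˡ : ∀ j a x → signed j (a * x) ≈ a * signed j x
  signed-*ˡ j a x = begin
    signed j (a * x)       ≈⟨ signed-unfold j (a * x) ⟩
    signed j 1# * (a * x)  ≈⟨ x∙yz≈y∙xz _ a x ⟩
    a * (signed j 1# * x)  ≈⟨ *-congˡ (signed-unfold j x) ⟨
    a * signed j x         ∎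

  signed-neg : ∀ j x → signed j (- x) ≈ - signed j x
  signed-neg j x = begin
    signed j (- x)        ≈⟨ signed-unfold j (- x) ⟩
    signed j 1# * - x     ≈⟨ -‿distribʳ-* _ x ⟨
    - (signed j 1# * x)   ≈⟨ -‿cong (signed-unfold j x) ⟨
    - signed j x          ∎

  signed-zero : ∀ j → signed j 0# ≈ 0#
  signed-zero j = trans (signed-unfold j 0#) (zeroʳ _)

  signed-comm : ∀ i j x → signed i (signed j x) ≈ signed j (signed i x)
  signed-comm i j x = begin
    signed i (signed j x)  ≈⟨ signed-unfold i _ ⟩
    si * signed j x        ≈⟨ *-congˡ (signed-unfold j x) ⟩
    si * (sj * x)          ≈⟨ x∙yz≈y∙xz si sj x ⟩
    sj * (si * x)          ≈⟨ *-congˡ (signed-unfold i x) ⟨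
    sj * signed i x        ≈⟨ signed-unfold j _ ⟨
    signed j (signed i x)  ∎
    where
    si sj : C
    si = signed i 1#
    sj = signed j 1#

  signed-sum : ∀ j {n} (f : Fin n → C) → signed j (sum f) ≈ sum (λ i → signed j (f i))
  signed-sum j f = begin
    signed j (sum f)                ≈⟨ signed-unfold j (sum f) ⟩
    signed j 1# * sum f             ≈⟨ *-distribˡ-sum _ f ⟩
    sum (λ i → signed j 1# * f i)   ≈⟨ sum-cong-≋ (λ i → signed-unfold j (f i)) ⟨
    sum (λ i → signed j (f i))      ∎

  det-cong : ∀ {n} {M N : Matrix C n} → (∀ i j → M i j ≈ N i j) → det M ≈ det N
  det-cong {zero}  M≈N = refl
  det-cong {suc n} M≈N =
    sum-cong-≋ (λ j → signed-cong (toℕ j) (*-cong (M≈N zero j) (det-cong (λ r c → M≈N (suc r) (punchIn j c)))))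

  det-firstColumnExpansion : ∀ {k} (M : Matrix C (suc k)) →
    det M ≈ sum (λ i → signed (toℕ i) (M i zero * det (firstColumnMinor M i)))
  det-firstColumnExpansion {zero}  M = refl
  det-firstColumnExpansion {suc k} M = +-congˡ (begin
    sum (λ j → signed (suc (toℕ j)) (a j * det (minor M (suc j))))
      ≈⟨ sum-cong-≋ (λ j → signed-cong (suc (toℕ j)) (*-congˡ {a j} (det-firstColumnExpansion (minor M (suc j))))) ⟩
    sum (λ j → signed (suc (toℕ j)) (a j * sum (λ i → signed (toℕ i) (b i * D i j))))
      ≈⟨ sum-cong-≋ (λ j → pull-out (toℕ j) (a j) (λ i → signed (toℕ i) (b i * D i j))) ⟩
    sum (λ j → sum (λ i → - (a j * signed (toℕ j) (signed (toℕ i) (b i * D i j)))))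
      ≈⟨ ∑-comm (λ j i → - (a j * signed (toℕ j) (signed (toℕ i) (b i * D i j)))) ⟩
    sum (λ i → sum (λ j → - (a j * signed (toℕ j) (signed (toℕ i) (b i * D i j)))))
      ≈⟨ sum-cong-≋ (λ i → sum-cong-≋ (λ j → -‿cong (exchange (toℕ i) (toℕ j) (a j) (b i) (D i j)))) ⟩
    sum (λ i → sum (λ j → - (b i * signed (toℕ i) (signed (toℕ j) (a j * D i j)))))
      ≈⟨ sum-cong-≋ (λ i → pull-out (toℕ i) (b i) (λ j → signed (toℕ j) (a j * D i j))) ⟨
    sum (λ i → signed (suc (toℕ i)) (b i * det (firstColumnMinor M (suc i)))) ∎)
    where
    a b : Fin (suc k) → C
    a j = M zero (suc j)
    b i = M (suc i) zero
    D : Fin (suc k) → Fin (suc k) → C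
    D i j = det (λ r c → M (suc (punchIn i r)) (suc (punchIn j c)))

    pull-out : ∀ {m} j x (g : Fin m → C) → signed (suc j) (x * sum g) ≈ sum (λ i → - (x * signed j (g i)))
    pull-out j x g = begin
      signed (suc j) (x * sum g)        ≈⟨ signed-suc j _ ⟩
      - signed j (x * sum g)            ≈⟨ -‿cong (signed-*ˡ j x _) ⟩
      - (x * signed j (sum g))          ≈⟨ -‿cong (*-congˡ (signed-sum j g)) ⟩
      - (x * sum (λ i → signed j (g i))) ≈⟨ -‿cong (*-distribˡ-sum x (λ i → signed j (g i))) ⟩
      - sum (λ i → x * signed j (g i))  ≈⟨ -‿sum (λ i → x * signed j (g i)) ⟩
      sum (λ i → - (x * signed j (g i))) ∎

    exchange : ∀ i j x y d → x * signed j (signed i (y * d)) ≈ y * signed i (signed j (x * d))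
    exchange i j x y d = begin
      x * signed j (signed i (y * d))  ≈⟨ *-congˡ (signed-cong j (signed-*ˡ i y d)) ⟩
      x * signed j (y * signed i d)    ≈⟨ *-congˡ (signed-*ˡ j y _) ⟩
      x * (y * signed j (signed i d))  ≈⟨ x∙yz≈y∙xz x y _ ⟩
      y * (x * signed j (signed i d))  ≈⟨ *-congˡ (*-congˡ (signed-comm j i d)) ⟩
      y * (x * signed i (signed j d))  ≈⟨ *-congˡ (signed-*ˡ i x _) ⟨
      y * signed i (x * signed j d)    ≈⟨ *-congˡ (signed-cong i (signed-*ˡ j x d)) ⟨
      y * signed i (signed j (x * d))  ∎

  det-transpose : ∀ {n} (M : Matrix C n) → det (transpose M) ≈ det M
  det-transpose {zero}  M = refl
  det-transpose {suc k} M = begin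
    det (transpose M)
      ≈⟨ sum-cong-≋ (λ i → signed-cong (toℕ i) (*-congˡ {M i zero} (det-transpose (firstColumnMinor M i)))) ⟩
    sum (λ i → signed (toℕ i) (M i zero * det (firstColumnMinor M i)))
      ≈⟨ det-firstColumnExpansion M ⟨
    det M ∎

  det-scaleRows : ∀ {n} (s : Fin n → C) (M : Matrix C n) → det (λ i j → s i * M i j) ≈ product s * det M
  det-scaleRows {zero}  s M = sym (*-identityˡ 1#)
  det-scaleRows {suc k} s M = begin
    sum (λ j → signed (toℕ j) ((s zero * M zero j) * det (λ r c → s (suc r) * minor M j r c)))
      ≈⟨ sum-cong-≋ (λ j → signed-cong (toℕ j)
           (*-congˡ {s zero * M zero j} (det-scaleRows (λ i → s (suc i)) (minor M j)))) ⟩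
    sum (λ j → signed (toℕ j) ((s zero * M zero j) * (P * det (minor M j))))
      ≈⟨ sum-cong-≋ (λ j → signed-cong (toℕ j) (interchange (s zero) (M zero j) P (det (minor M j)))) ⟩
    sum (λ j → signed (toℕ j) ((s zero * P) * (M zero j * det (minor M j))))
      ≈⟨ sum-cong-≋ (λ j → signed-*ˡ (toℕ j) (s zero * P) (M zero j * det (minor M j))) ⟩
    sum (λ j → (s zero * P) * signed (toℕ j) (M zero j * det (minor M j)))
      ≈⟨ *-distribˡ-sum (s zero * P) (λ j → signed (toℕ j) (M zero j * det (minor M j))) ⟨
    (s zero * P) * det M ∎
    where
    P : C
    P = product (λ i → s (suc i))

  det-scaleColumns : ∀ {n} (s : Fin n → C) (M : Matrix C n) → det (λ i j → s j * M i j) ≈ product s * det M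
  det-scaleColumns s M = begin
    det (λ i j → s j * M i j)           ≈⟨ det-transpose (λ i j → s i * M j i) ⟩
    det (λ i j → s i * M j i)           ≈⟨ det-scaleRows s (transpose M) ⟩
    product s * det (transpose M)       ≈⟨ *-congˡ (det-transpose M) ⟩
    product s * det M                   ∎

  det-conjugateInvolution : ∀ {n} (s : Fin n → C) (M : Matrix C n) → (∀ i → s i * s i ≈ 1#) →
                            det (λ i j → s i * (s j * M i j)) ≈ det M
  det-conjugateInvolution {n} s M s²≈1 = begin
    det (λ i j → s i * (s j * M i j))   ≈⟨ det-scaleRows s (λ i j → s j * M i j) ⟩
    product s * det (λ i j → s j * M i j) ≈⟨ *-congˡ (det-scaleColumns s M) ⟩
    product s * (product s * det M)     ≈⟨ *-assoc _ _ _ ⟨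
    (product s * product s) * det M     ≈⟨ *-congʳ (product-distrib-* s s) ⟨
    product (λ i → s i * s i) * det M   ≈⟨ *-congʳ (trans (product-cong s²≈1) (product-replicate-one n)) ⟩
    1# * det M                          ≈⟨ *-identityˡ (det M) ⟩
    det M                               ∎

  signed-negated : ∀ j x {d d′} → d′ ≈ - d → signed j (x * d′) ≈ - signed j (x * d)
  signed-negated j x {d} {d′} d′≈-d = begin
    signed j (x * d′)     ≈⟨ signed-cong j (*-congˡ d′≈-d) ⟩
    signed j (x * - d)    ≈⟨ signed-cong j (-‿distribʳ-* x d) ⟨
    signed j (- (x * d))  ≈⟨ signed-neg j (x * d) ⟩
    - signed j (x * d)    ∎

  det-swapFirstColumns : ∀ {k} (M : Matrix C (suc (suc k))) → det (λ i j → M i (swap 0 j)) ≈ - det M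
  det-swapFirstColumns {k} M = begin
    det N
      ≈⟨ +-cong (*-congˡ {M zero (suc zero)} (det-cong minor₀))
                (+-cong (-‿cong (*-congˡ {M zero zero} (det-cong minor₁))) (later-terms k M)) ⟩
    x₁ + (- x₀ + - r)        ≈⟨ x+yz≈y+xz x₁ (- x₀) (- r) ⟩
    - x₀ + (x₁ + - r)        ≈⟨ +-congˡ (+-congʳ (-‿involutive x₁)) ⟨
    - x₀ + (- - x₁ + - r)    ≈⟨ +-congˡ (-‿+-comm (- x₁) r) ⟩
    - x₀ + - (- x₁ + r)      ≈⟨ -‿+-comm x₀ (- x₁ + r) ⟩
    - det M                  ∎
    where
    N : Matrix C (suc (suc k))
    N i j = M i (swap 0 j)
    x₀ x₁ r : C
    x₀ = M zero zero * det (minor M zero)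
    x₁ = M zero (suc zero) * det (minor M (suc zero))
    r  = sum (λ j → signed (toℕ j) (M zero (suc (suc j)) * det (minor M (suc (suc j)))))

    minor₀ : ∀ i j → minor N zero i j ≈ minor M (suc zero) i j
    minor₀ i zero    = refl
    minor₀ i (suc j) = refl
    minor₁ : ∀ i j → minor N (suc zero) i j ≈ minor M zero i j
    minor₁ i zero    = refl
    minor₁ i (suc j) = refl

    later-terms : ∀ k (M : Matrix C (suc (suc k))) →
      sum (λ j → signed (toℕ j) (M zero (suc (suc j)) * det (minor (λ i j → M i (swap 0 j)) (suc (suc j)))))
      ≈ - sum (λ j → signed (toℕ j) (M zero (suc (suc j)) * det (minor M (suc (suc j)))))
    later-terms zero    M = sym -0#≈0#
    later-terms (suc k) M = begin
      sum (λ j → signed (toℕ j) (M zero (suc (suc j)) * det (minor (λ i j → M i (swap 0 j)) (suc (suc j)))))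
        ≈⟨ sum-cong-≋ (λ j → signed-negated (toℕ j) (M zero (suc (suc j)))
              (trans (det-cong (swapped-minor j)) (det-swapFirstColumns (minor M (suc (suc j)))))) ⟩
      sum (λ j → - signed (toℕ j) (M zero (suc (suc j)) * det (minor M (suc (suc j)))))
        ≈⟨ -‿sum (λ j → signed (toℕ j) (M zero (suc (suc j)) * det (minor M (suc (suc j))))) ⟨
      - sum (λ j → signed (toℕ j) (M zero (suc (suc j)) * det (minor M (suc (suc j))))) ∎
      where
      swapped-minor : ∀ j r c → minor (λ i j → M i (swap 0 j)) (suc (suc j)) r c ≈ minor M (suc (suc j)) r (swap 0 c)
      swapped-minor j r zero          = refl
      swapped-minor j r (suc zero)    = refl
      swapped-minor j r (suc (suc c)) = refl

  det-swapRows : ∀ r {n} (M : Matrix C n) → suc (suc r) ≤ n → det (λ i j → M (swap r i) j) ≈ - det M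
  det-swapRows zero    {suc (suc k)} M _ = begin
    det (λ i j → M (swap 0 i) j)   ≈⟨ det-transpose (λ i j → M (swap 0 j) i) ⟩
    det (λ i j → M (swap 0 j) i)   ≈⟨ det-swapFirstColumns (transpose M) ⟩
    - det (transpose M)            ≈⟨ -‿cong (det-transpose M) ⟩
    - det M                        ∎
  det-swapRows zero    {suc zero}    M (s≤s ())
  det-swapRows (suc r) {suc k} M (s≤s r+2≤k) = begin
    det (λ i j → M (swap (suc r) i) j)
      ≈⟨ sum-cong-≋ (λ j → signed-negated (toℕ j) (M zero j) (det-swapRows r (minor M j) r+2≤k)) ⟩
    sum (λ j → - signed (toℕ j) (M zero j * det (minor M j)))
      ≈⟨ -‿sum (λ j → signed (toℕ j) (M zero j * det (minor M j))) ⟨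
    - det M ∎

  det-conjugateSwap : ∀ r {n} (M : Matrix C n) → suc (suc r) ≤ n → det (λ i j → M (swap r i) (swap r j)) ≈ det M
  det-conjugateSwap r {n} M r+2≤n = begin
    det (λ i j → M (swap r i) (swap r j))  ≈⟨ det-swapRows r N r+2≤n ⟩
    - det N                                ≈⟨ -‿cong (det-transpose N) ⟨
    - det (transpose N)                    ≈⟨ -‿cong (det-swapRows r (transpose M) r+2≤n) ⟩
    - - det (transpose M)                  ≈⟨ -‿involutive _ ⟩
    det (transpose M)                      ≈⟨ det-transpose M ⟩
    det M                                  ∎
    where
    N : Matrix C n
    N i j = M i (swap r j)

  signed-zeroFactor : ∀ j {x} d → x ≈ 0# → signed j (x * d) ≈ 0#
  signed-zeroFactor j d x≈0 = trans (signed-cong j (trans (*-congʳ x≈0) (zeroˡ d))) (signed-zero j)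

  det-zeroFirstColumn : ∀ {k} (M : Matrix C (suc k)) → (∀ i → M i zero ≈ 0#) → det M ≈ 0#
  det-zeroFirstColumn M column≈0 = trans (det-firstColumnExpansion M)
    (sum-zero (λ i → signed (toℕ i) (M i zero * det (firstColumnMinor M i)))
      (λ i → signed-zeroFactor (toℕ i) (det (firstColumnMinor M i)) (column≈0 i)))

  det-upperTriangular : ∀ {n} (M : Matrix C n) → (∀ r c → toℕ c < toℕ r → M r c ≈ 0#) →
                        det M ≈ product (λ i → M i i)
  det-upperTriangular {zero}  M _     = refl
  det-upperTriangular {suc k} M lower≈0 = begin
    det M
      ≈⟨ det-firstColumnExpansion M ⟩
    sum (λ i → signed (toℕ i) (M i zero * det (firstColumnMinor M i)))
      ≈⟨ sum-head (λ i → signed (toℕ i) (M i zero * det (firstColumnMinor M i)))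
           (λ i → signed-zeroFactor (suc (toℕ i)) (det (firstColumnMinor M (suc i))) (lower≈0 (suc i) zero (s≤s z≤n))) ⟩
    M zero zero * det (firstColumnMinor M zero)
      ≈⟨ *-congˡ (det-upperTriangular (firstColumnMinor M zero) (λ r c c<r → lower≈0 (suc r) (suc c) (s≤s c<r))) ⟩
    M zero zero * product (λ i → M (suc i) (suc i)) ∎

  det-firstColumnLastOnly : ∀ {k} (M : Matrix C (suc k)) → (∀ i → M (inject₁ i) zero ≈ 0#) →
    det M ≈ signed (toℕ (fromℕ k)) (M (fromℕ k) zero * det (firstColumnMinor M (fromℕ k)))
  det-firstColumnLastOnly M init≈0 = trans (det-firstColumnExpansion M)
    (sum-last (λ i → signed (toℕ i) (M i zero * det (firstColumnMinor M i)))
      (λ i → signed-zeroFactor (toℕ (inject₁ i)) (det (firstColumnMinor M (inject₁ i))) (init≈0 i)))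

module PolynomialRing where

  open import Data.Integer using (ℤ; +_; -_; _+_; _*_)
  import Data.Integer.Properties as ℤ
  open import Data.List using ([]; _∷_)
  open import Data.Product using (_,_)
  open import Algebra.Structures using (IsAbelianGroup)
  import Relation.Binary.Reasoning.Setoid as SetoidReasoning
  open import Relation.Binary.PropositionalEquality using (_≡_; refl; sym; trans; cong; cong₂)

  infix 4 _≋_
  -- A record rather than Defs._≈P_, so that both polynomials can be read off the type.
  record _≋_ (p q : Poly) : Set where
    constructor coeffwise
    field coeff-≡ : ∀ k → coeff p k ≡ coeff q k
  open _≋_ public

  ≋-refl : ∀ {p} → p ≋ p
  ≋-refl = coeffwise λ _ → refl

  ≋-sym : ∀ {p q} → p ≋ q → q ≋ p
  ≋-sym p≋q = coeffwise λ k → sym (coeff-≡ p≋q k)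

  ≋-trans : ∀ {p q r} → p ≋ q → q ≋ r → p ≋ r
  ≋-trans p≋q q≋r = coeffwise λ k → trans (coeff-≡ p≋q k) (coeff-≡ q≋r k)

  ∷-cong : ∀ {a b p q} → a ≡ b → p ≋ q → (a ∷ p) ≋ (b ∷ q)
  ∷-cong a≡b p≋q = coeffwise λ { zero → a≡b ; (suc k) → coeff-≡ p≋q k }

  ∷-≋[] : ∀ {a p} → a ≡ + 0 → p ≋ [] → (a ∷ p) ≋ []
  ∷-≋[] a≡0 p≋[] = coeffwise λ { zero → a≡0 ; (suc k) → coeff-≡ p≋[] k }

  coeff-+P : ∀ p q k → coeff (p +P q) k ≡ coeff p k + coeff q k
  coeff-+P []      q       k       = sym (ℤ.+-identityˡ _)
  coeff-+P (a ∷ p) []      k       = sym (ℤ.+-identityʳ _)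
  coeff-+P (a ∷ p) (b ∷ q) zero    = refl
  coeff-+P (a ∷ p) (b ∷ q) (suc k) = coeff-+P p q k

  coeff-negP : ∀ p k → coeff (negP p) k ≡ - coeff p k
  coeff-negP []      k       = refl
  coeff-negP (a ∷ p) zero    = refl
  coeff-negP (a ∷ p) (suc k) = coeff-negP p k

  coeff-scaleP : ∀ c p k → coeff (scaleP c p) k ≡ c * coeff p k
  coeff-scaleP c []      k       = sym (ℤ.*-zeroʳ c)
  coeff-scaleP c (a ∷ p) zero    = refl
  coeff-scaleP c (a ∷ p) (suc k) = coeff-scaleP c p k

  +P-cong : ∀ {p p′ q q′} → p ≋ p′ → q ≋ q′ → p +P q ≋ p′ +P q′
  +P-cong {p} {p′} {q} {q′} p≋p′ q≋q′ = coeffwise λ k →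
    trans (coeff-+P p q k) (trans (cong₂ _+_ (coeff-≡ p≋p′ k) (coeff-≡ q≋q′ k)) (sym (coeff-+P p′ q′ k)))

  negP-cong : ∀ {p p′} → p ≋ p′ → negP p ≋ negP p′
  negP-cong {p} {p′} p≋p′ = coeffwise λ k →
    trans (coeff-negP p k) (trans (cong -_ (coeff-≡ p≋p′ k)) (sym (coeff-negP p′ k)))

  scaleP-cong : ∀ c {p p′} → p ≋ p′ → scaleP c p ≋ scaleP c p′
  scaleP-cong c {p} {p′} p≋p′ = coeffwise λ k →
    trans (coeff-scaleP c p k) (trans (cong (c *_) (coeff-≡ p≋p′ k)) (sym (coeff-scaleP c p′ k)))

  +P-assoc : ∀ p q r → (p +P q) +P r ≋ p +P (q +P r)
  +P-assoc []      q       r       = ≋-refl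
  +P-assoc (a ∷ p) []      r       = ≋-refl
  +P-assoc (a ∷ p) (b ∷ q) []      = ≋-refl
  +P-assoc (a ∷ p) (b ∷ q) (c ∷ r) = ∷-cong (ℤ.+-assoc a b c) (+P-assoc p q r)

  +P-comm : ∀ p q → p +P q ≋ q +P p
  +P-comm []      []      = ≋-refl
  +P-comm []      (b ∷ q) = ≋-refl
  +P-comm (a ∷ p) []      = ≋-refl
  +P-comm (a ∷ p) (b ∷ q) = ∷-cong (ℤ.+-comm a b) (+P-comm p q)

  +P-identityʳ : ∀ p → p +P [] ≋ p
  +P-identityʳ []      = ≋-refl
  +P-identityʳ (a ∷ p) = ≋-refl

  +P-inverseˡ : ∀ p → negP p +P p ≋ []
  +P-inverseˡ []      = ≋-refl
  +P-inverseˡ (a ∷ p) = ∷-≋[] (ℤ.+-inverseˡ a) (+P-inverseˡ p)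

  +P-inverseʳ : ∀ p → p +P negP p ≋ []
  +P-inverseʳ p = ≋-trans (+P-comm p (negP p)) (+P-inverseˡ p)

  +P-isAbelianGroup : IsAbelianGroup _≋_ _+P_ [] negP
  +P-isAbelianGroup = record
    { isGroup = record
      { isMonoid = record
        { isSemigroup = record
          { isMagma = record
            { isEquivalence = record { refl = ≋-refl ; sym = ≋-sym ; trans = ≋-trans }
            ; ∙-cong = +P-cong }
          ; assoc = +P-assoc }
        ; identity = (λ _ → ≋-refl) , +P-identityʳ }
      ; inverse = +P-inverseˡ , +P-inverseʳ
      ; ⁻¹-cong = negP-cong }
    ; comm = +P-comm }

  +P-commutativeSemigroup : CommutativeSemigroup 0ℓ 0ℓ
  +P-commutativeSemigroup = record
    { isCommutativeSemigroup = IsAbelianGroup.isCommutativeSemigroup +P-isAbelianGroup }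

  open import Algebra.Properties.CommutativeSemigroup +P-commutativeSemigroup
    using (interchange; x∙yz≈y∙xz)

  scaleP-+P : ∀ c p q → scaleP c (p +P q) ≋ scaleP c p +P scaleP c q
  scaleP-+P c []      q       = ≋-refl
  scaleP-+P c (a ∷ p) []      = ≋-refl
  scaleP-+P c (a ∷ p) (b ∷ q) = ∷-cong (ℤ.*-distribˡ-+ c a b) (scaleP-+P c p q)

  scaleP-scaleP : ∀ c d p → scaleP (c * d) p ≋ scaleP c (scaleP d p)
  scaleP-scaleP c d []      = ≋-refl
  scaleP-scaleP c d (a ∷ p) = ∷-cong (ℤ.*-assoc c d a) (scaleP-scaleP c d p)

  scaleP-zero : ∀ p → scaleP (+ 0) p ≋ []
  scaleP-zero []      = ≋-refl
  scaleP-zero (a ∷ p) = ∷-≋[] refl (scaleP-zero p)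

  scaleP-one : ∀ p → scaleP (+ 1) p ≋ p
  scaleP-one []      = ≋-refl
  scaleP-one (a ∷ p) = ∷-cong (ℤ.*-identityˡ a) (scaleP-one p)

  *P-congʳ : ∀ p {q q′} → q ≋ q′ → p *P q ≋ p *P q′
  *P-congʳ []      q≋q′ = ≋-refl
  *P-congʳ (a ∷ p) q≋q′ = +P-cong (scaleP-cong a q≋q′) (∷-cong refl (*P-congʳ p q≋q′))

  *P-distribˡ : ∀ p q r → p *P (q +P r) ≋ p *P q +P p *P r
  *P-distribˡ []      q r = ≋-refl
  *P-distribˡ (a ∷ p) q r = ≋-trans
    (+P-cong (scaleP-+P a q r) (∷-cong refl (*P-distribˡ p q r)))
    (interchange (scaleP a q) (scaleP a r) (+ 0 ∷ p *P q) (+ 0 ∷ p *P r))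

  *P-zeroʳ : ∀ p → p *P [] ≋ []
  *P-zeroʳ []      = ≋-refl
  *P-zeroʳ (a ∷ p) = ∷-≋[] refl (*P-zeroʳ p)

  *P-∷ʳ : ∀ p b q → p *P (b ∷ q) ≋ scaleP b p +P (+ 0 ∷ p *P q)
  *P-∷ʳ []      b q = ≋-sym (∷-≋[] refl ≋-refl)
  *P-∷ʳ (a ∷ p) b q = ∷-cong (cong (_+ + 0) (ℤ.*-comm a b))
    (≋-trans (+P-cong ≋-refl (*P-∷ʳ p b q)) (x∙yz≈y∙xz (scaleP a q) (scaleP b p) (+ 0 ∷ p *P q)))

  *P-comm : ∀ p q → p *P q ≋ q *P p
  *P-comm []      q = ≋-sym (*P-zeroʳ q)
  *P-comm (a ∷ p) q = ≋-trans (+P-cong ≋-refl (∷-cong refl (*P-comm p q))) (≋-sym (*P-∷ʳ q a p))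

  *P-congˡ : ∀ {p p′} q → p ≋ p′ → p *P q ≋ p′ *P q
  *P-congˡ {p} {p′} q p≋p′ = ≋-trans (*P-comm p q) (≋-trans (*P-congʳ q p≋p′) (*P-comm q p′))

  *P-cong : ∀ {p p′ q q′} → p ≋ p′ → q ≋ q′ → p *P q ≋ p′ *P q′
  *P-cong {p′ = p′} {q = q} p≋p′ q≋q′ = ≋-trans (*P-congˡ q p≋p′) (*P-congʳ p′ q≋q′)

  *P-distribʳ : ∀ r p q → (p +P q) *P r ≋ p *P r +P q *P r
  *P-distribʳ r p q = ≋-trans (*P-comm (p +P q) r)
    (≋-trans (*P-distribˡ r p q) (+P-cong (*P-comm r p) (*P-comm r q)))

  scaleP-*P : ∀ c p q → scaleP c p *P q ≋ scaleP c (p *P q)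
  scaleP-*P c []      q = ≋-refl
  scaleP-*P c (a ∷ p) q = ≋-trans
    (+P-cong (scaleP-scaleP c a q) (∷-cong (sym (ℤ.*-zeroʳ c)) (scaleP-*P c p q)))
    (≋-sym (scaleP-+P c (scaleP a q) (+ 0 ∷ p *P q)))

  *P-assoc : ∀ p q r → (p *P q) *P r ≋ p *P (q *P r)
  *P-assoc []      q r = ≋-refl
  *P-assoc (a ∷ p) q r = ≋-trans (*P-distribʳ r (scaleP a q) (+ 0 ∷ p *P q))
    (+P-cong (scaleP-*P a q r) (+P-cong (scaleP-zero r) (∷-cong refl (*P-assoc p q r))))

  *P-identityˡ : ∀ p → constP (+ 1) *P p ≋ p
  *P-identityˡ p = ≋-trans (+P-cong (scaleP-one p) (∷-≋[] refl ≋-refl)) (+P-identityʳ p)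

  *P-identityʳ : ∀ p → p *P constP (+ 1) ≋ p
  *P-identityʳ p = ≋-trans (*P-comm p (constP (+ 1))) (*P-identityˡ p)

  ℤ[z] : CommutativeRing 0ℓ 0ℓ
  ℤ[z] = record
    { Carrier = Poly ; _≈_ = _≋_ ; _+_ = _+P_ ; _*_ = _*P_ ; -_ = negP ; 0# = [] ; 1# = constP (+ 1)
    ; isCommutativeRing = record
      { isRing = record
        { +-isAbelianGroup = +P-isAbelianGroup
        ; *-cong = *P-cong
        ; *-assoc = *P-assoc
        ; *-identity = *P-identityˡ , *P-identityʳ
        ; distrib = (λ p q r → *P-distribˡ p q r) , *P-distribʳ }
      ; *-comm = *P-comm } }

  module ≋-Reasoning = SetoidReasoning (CommutativeRing.setoid ℤ[z])

open import Data.Nat using (_*_)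
open import Data.Nat.Properties
open import Data.Fin.Properties using (toℕ-injective; toℕ<n; toℕ-fromℕ; toℕ-inject₁)
open import Data.Integer using (ℤ; +_; -_; -1ℤ; 1ℤ; ∣_∣) renaming (_+_ to _+ℤ_; _*_ to _*ℤ_)
import Data.Integer.Properties as ℤ
open import Data.List using ([]; _∷_)
open import Data.Bool using (Bool; true; false; if_then_else_; _∧_; not)
open import Data.Bool.Properties using (∧-zeroʳ)
open import Data.Product using (Σ; _×_; _,_)
open import Data.Empty using (⊥; ⊥-elim)
open import Function using (_∘_)
open import Function.Definitions using (Injective)
open import Relation.Binary.PropositionalEquality
  using (_≢_; ≢-sym; refl; sym; trans; cong; cong₂; subst₂; module ≡-Reasoning)
open import Relation.Binary.Definitions using (tri<; tri≈; tri>)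
open import Relation.Nullary using (¬_)
open import Relation.Nullary.Decidable using (dec-true; dec-false; yes; no)

module CharacteristicPolynomial where

  open PolynomialRing
  module Detℤ[z] = Determinant ℤ[z]
  module Detℤ    = Determinant ℤ.+-*-commutativeRing
  open Detℤ[z] using (det; det-cong)

  ≡⇒≋ : ∀ {p q} → p ≡ q → p ≋ q
  ≡⇒≋ refl = ≋-refl

  sumFin≡sum : ∀ {k} (f : Fin k → Poly) → sumFin f ≡ Detℤ[z].sum f
  sumFin≡sum {zero}  f = refl
  sumFin≡sum {suc k} f = cong (f zero +P_) (sumFin≡sum (f ∘ suc))

  signP≡signed : ∀ j p → signP j p ≡ Detℤ[z].signed j p
  signP≡signed zero          p = refl
  signP≡signed (suc zero)    p = refl
  signP≡signed (suc (suc j)) p = signP≡signed j p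

  Defs-det≡det : ∀ {n} (M : Matrix Poly n) → Defs.det M ≡ det M
  Defs-det≡det {zero}  M = refl
  Defs-det≡det {suc k} M = trans (sumFin≡sum (λ j → signP (toℕ j) (M zero j *P Defs.det (minor M j))))
    (Detℤ[z].sum-cong-≗ λ j →
    trans (signP≡signed (toℕ j) _) (cong (λ d → Detℤ[z].signed (toℕ j) (M zero j *P d)) (Defs-det≡det (minor M j))))

  zI : ∀ {n} → Fin n → Fin n → Poly
  zI i j = if toℕ i ≡ᵇ toℕ j then zP else []

  charMatrix : ∀ {n} → Matrix ℤ n → Matrix Poly n
  charMatrix M i j = zI i j +P negP (constP (M i j))

  charPoly≋det : ∀ {n} (M : Matrix ℤ n) → charPoly M ≋ det (charMatrix M)
  charPoly≋det M = ≡⇒≋ (Defs-det≡det (charMatrix M))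

  charPoly-cong : ∀ {n} {M N : Matrix ℤ n} → (∀ i j → M i j ≡ N i j) → charPoly M ≋ charPoly N
  charPoly-cong {M = M} {N} M≡N = ≋-trans (charPoly≋det M) (≋-trans
    (det-cong λ i j → ≡⇒≋ (cong (λ x → zI i j +P negP (constP x)) (M≡N i j)))
    (≋-sym (charPoly≋det N)))

  zI-diag : ∀ {n} (i : Fin n) → zI i i ≡ zP
  zI-diag i = cong (if_then zP else []) (dec-true (toℕ i ≟ toℕ i) refl)

  zI-off : ∀ {n} {i j : Fin n} → i ≢ j → zI i j ≡ []
  zI-off {i = i} {j} i≢j = cong (if_then zP else []) (dec-false (toℕ i ≟ toℕ j) (i≢j ∘ toℕ-injective))

  zI-reindex : ∀ {n} (π : Fin n → Fin n) → Injective _≡_ _≡_ π → ∀ i j → zI (π i) (π j) ≡ zI i j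
  zI-reindex π π-inj i j with i Fin.≟ j
  ... | yes refl = trans (zI-diag (π i)) (sym (zI-diag i))
  ... | no  i≢j  = trans (zI-off (i≢j ∘ π-inj)) (sym (zI-off i≢j))

  charPoly-reindex : ∀ {n} (M : Matrix ℤ n) (π : Fin n → Fin n) → Injective _≡_ _≡_ π →
                     charPoly (λ i j → M (π i) (π j)) ≋ det (λ i j → charMatrix M (π i) (π j))
  charPoly-reindex M π π-inj = ≋-trans (charPoly≋det (λ i j → M (π i) (π j)))
    (det-cong λ i j → ≡⇒≋ (cong (_+P negP (constP (M (π i) (π j)))) (sym (zI-reindex π π-inj i j))))

  charPoly-conjugateSwap : ∀ r {n} (M : Matrix ℤ n) → suc (suc r) ≤ n →
                           charPoly (λ i j → M (swap r i) (swap r j)) ≋ charPoly M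
  charPoly-conjugateSwap r M r+2≤n = ≋-trans (charPoly-reindex M (swap r) swap-injective)
    (≋-trans (Detℤ[z].det-conjugateSwap r (charMatrix M) r+2≤n) (≋-sym (charPoly≋det M)))
    where
    swap-injective : Injective _≡_ _≡_ (swap r)
    swap-injective {i} {j} eq = trans (sym (swap-involutive r i)) (trans (cong (swap r) eq) (swap-involutive r j))

  private
    module ℤ[z] = CommutativeRing ℤ[z]
  open import Algebra.Properties.Ring ℤ[z].ring using (x[y-z]≈xy-xz)
  open ≋-Reasoning

  constP-* : ∀ a b → constP (a *ℤ b) ≋ constP a *P constP b
  constP-* a b = ∷-cong (sym (ℤ.+-identityʳ (a *ℤ b))) ≋-refl

  zI-conjugate : ∀ {n} (e : Fin n → ℤ) → (∀ i → e i *ℤ e i ≡ + 1) → ∀ i j →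
                        constP (e i) *P (constP (e j) *P zI i j) ≋ zI i j
  zI-conjugate e e²≡1 i j with i Fin.≟ j
  ... | yes refl = begin
    constP (e i) *P (constP (e i) *P zI i i)  ≈⟨ ℤ[z].*-assoc (constP (e i)) (constP (e i)) _ ⟨
    (constP (e i) *P constP (e i)) *P zI i i  ≈⟨ ℤ[z].*-congʳ (constP-* (e i) (e i)) ⟨
    constP (e i *ℤ e i) *P zI i i             ≈⟨ ℤ[z].*-congʳ (≡⇒≋ (cong constP (e²≡1 i))) ⟩
    constP (+ 1) *P zI i i                    ≈⟨ ℤ[z].*-identityˡ (zI i i) ⟩
    zI i i                                    ∎
  ... | no i≢j rewrite zI-off i≢j =
    ≋-trans (ℤ[z].*-congˡ {constP (e i)} (*P-zeroʳ (constP (e j)))) (*P-zeroʳ (constP (e i)))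

  charMatrix-conjugate : ∀ {n} (M : Matrix ℤ n) (e : Fin n → ℤ) → (∀ i → e i *ℤ e i ≡ + 1) → ∀ i j →
    charMatrix (λ i j → e i *ℤ (e j *ℤ M i j)) i j ≋ constP (e i) *P (constP (e j) *P charMatrix M i j)
  charMatrix-conjugate M e e²≡1 i j = begin
    zI i j +P negP (constP (e i *ℤ (e j *ℤ M i j)))
      ≈⟨ ℤ[z].+-cong (zI-conjugate e e²≡1 i j) (ℤ[z].-‿cong constant-part) ⟨
    x *P (y *P zI i j) +P negP (x *P (y *P constP (M i j)))
      ≈⟨ x[y-z]≈xy-xz x (y *P zI i j) (y *P constP (M i j)) ⟨
    x *P (y *P zI i j +P negP (y *P constP (M i j)))
      ≈⟨ ℤ[z].*-congˡ {x} (x[y-z]≈xy-xz y (zI i j) (constP (M i j))) ⟨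
    x *P (y *P charMatrix M i j) ∎
    where
    x y : Poly
    x = constP (e i)
    y = constP (e j)
    constant-part : x *P (y *P constP (M i j)) ≋ constP (e i *ℤ (e j *ℤ M i j))
    constant-part = ≋-trans (ℤ[z].*-congˡ {x} (≋-sym (constP-* (e j) (M i j)))) (≋-sym (constP-* (e i) (e j *ℤ M i j)))

  charPoly-conjugateSignature : ∀ {n} (M : Matrix ℤ n) (e : Fin n → ℤ) → (∀ i → e i *ℤ e i ≡ + 1) →
                                charPoly (λ i j → e i *ℤ (e j *ℤ M i j)) ≋ charPoly M
  charPoly-conjugateSignature M e e²≡1 = begin
    charPoly (λ i j → e i *ℤ (e j *ℤ M i j))
      ≈⟨ charPoly≋det (λ i j → e i *ℤ (e j *ℤ M i j)) ⟩
    det (charMatrix (λ i j → e i *ℤ (e j *ℤ M i j)))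
      ≈⟨ det-cong (charMatrix-conjugate M e e²≡1) ⟩
    det (λ i j → constP (e i) *P (constP (e j) *P charMatrix M i j))
      ≈⟨ Detℤ[z].det-conjugateInvolution (constP ∘ e) (charMatrix M)
           (λ i → ≋-trans (≋-sym (constP-* (e i) (e i))) (≡⇒≋ (cong constP (e²≡1 i)))) ⟩
    det (charMatrix M)
      ≈⟨ charPoly≋det M ⟨
    charPoly M ∎

  coeff₀-*P : ∀ p q → coeff (p *P q) 0 ≡ coeff p 0 *ℤ coeff q 0
  coeff₀-*P []      q = sym (ℤ.*-zeroˡ (coeff q 0))
  coeff₀-*P (a ∷ p) q = trans (coeff-+P (scaleP a q) (+ 0 ∷ p *P q) 0) (trans (ℤ.+-identityʳ _) (coeff-scaleP a q 0))

  coeff₀-sum : ∀ {k} (f : Fin k → Poly) → coeff (Detℤ[z].sum f) 0 ≡ Detℤ.sum (λ i → coeff (f i) 0)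
  coeff₀-sum {zero}  f = refl
  coeff₀-sum {suc k} f =
    trans (coeff-+P (f zero) (Detℤ[z].sum (f ∘ suc)) 0) (cong (coeff (f zero) 0 +ℤ_) (coeff₀-sum (f ∘ suc)))

  coeff₀-signed : ∀ j p → coeff (Detℤ[z].signed j p) 0 ≡ Detℤ.signed j (coeff p 0)
  coeff₀-signed zero          p = refl
  coeff₀-signed (suc zero)    p = coeff-negP p 0
  coeff₀-signed (suc (suc j)) p = coeff₀-signed j p

  coeff₀-det : ∀ {n} (M : Matrix Poly n) → coeff (det M) 0 ≡ Detℤ.det (λ i j → coeff (M i j) 0)
  coeff₀-det {zero}  M = refl
  coeff₀-det {suc k} M = trans (coeff₀-sum (λ j → Detℤ[z].signed (toℕ j) (M zero j *P det (minor M j))))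
    (Detℤ.sum-cong-≗ λ j → trans (coeff₀-signed (toℕ j) (M zero j *P det (minor M j)))
      (cong (Detℤ.signed (toℕ j)) (trans (coeff₀-*P (M zero j) (det (minor M j)))
        (cong (coeff (M zero j) 0 *ℤ_) (coeff₀-det (minor M j))))))

  coeff₀-charMatrix : ∀ {n} (M : Matrix ℤ n) i j → coeff (charMatrix M i j) 0 ≡ - M i j
  coeff₀-charMatrix M i j with toℕ i ≡ᵇ toℕ j
  ... | true  = ℤ.+-identityˡ (- M i j)
  ... | false = refl

  coeff₀-charPoly : ∀ {n} (M : Matrix ℤ n) → coeff (charPoly M) 0 ≡ Detℤ.det (λ i j → - M i j)
  coeff₀-charPoly M = trans (coeff-≡ (charPoly≋det M) 0)
    (trans (coeff₀-det (charMatrix M)) (Detℤ.det-cong (coeff₀-charMatrix M)))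

open PolynomialRing using (_≋_; ≋-sym; ≋-trans; coeff-≡; module ≋-Reasoning)
open CharacteristicPolynomial

-- Strictly increasing maps Fin k → Fin (k + 1)

skip : ℕ → ℕ → ℕ
skip p a = if a <ᵇ p then a else suc a

skip-suc : ∀ p a → skip (suc p) (suc a) ≡ suc (skip p a)
skip-suc p a with a <ᵇ p
... | true  = refl
... | false = refl

increasing-tail : ∀ {a b} {σ : Fin (suc a) → Fin b} → StrictlyIncreasing σ → StrictlyIncreasing (σ ∘ suc)
increasing-tail σ↑ i j i<j = σ↑ (suc i) (suc j) (s≤s i<j)

tail-positive : ∀ {a b} {σ : Fin (suc a) → Fin b} → StrictlyIncreasing σ → ∀ i → 0 < toℕ (σ (suc i))
tail-positive σ↑ i = ≤-<-trans z≤n (σ↑ zero (suc i) z<s)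

positive-from-head : ∀ {a b y} {σ : Fin (suc a) → Fin (suc b)} → StrictlyIncreasing σ → σ zero ≡ suc y →
                     ∀ i → 0 < toℕ (σ i)
positive-from-head σ↑ σ0≡ zero    rewrite σ0≡ = z<s
positive-from-head σ↑ σ0≡ (suc i) = tail-positive σ↑ i

predFin : ∀ {b} (x : Fin (suc b)) → 0 < toℕ x → Fin b
predFin (suc y) _ = y

suc-predFin : ∀ {b} (x : Fin (suc b)) (x>0 : 0 < toℕ x) → suc (toℕ (predFin x x>0)) ≡ toℕ x
suc-predFin (suc y) _ = refl

lower : ∀ {a b} (σ : Fin a → Fin (suc b)) → (∀ i → 0 < toℕ (σ i)) → Fin a → Fin b
lower σ σ>0 i = predFin (σ i) (σ>0 i)

suc-lower : ∀ {a b} (σ : Fin a → Fin (suc b)) (σ>0 : ∀ i → 0 < toℕ (σ i)) i →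
            suc (toℕ (lower σ σ>0 i)) ≡ toℕ (σ i)
suc-lower σ σ>0 i = suc-predFin (σ i) (σ>0 i)

lower-increasing : ∀ {a b} {σ : Fin a → Fin (suc b)} (σ>0 : ∀ i → 0 < toℕ (σ i)) →
                   StrictlyIncreasing σ → StrictlyIncreasing (lower σ σ>0)
lower-increasing {σ = σ} σ>0 σ↑ i j i<j =
  s<s⁻¹ (subst₂ _<_ (sym (suc-lower σ σ>0 i)) (sym (suc-lower σ σ>0 j)) (σ↑ i j i<j))

lowerTail : ∀ {a b} {σ : Fin (suc a) → Fin (suc b)} → StrictlyIncreasing σ → Fin a → Fin b
lowerTail {σ = σ} σ↑ = lower (σ ∘ suc) (tail-positive σ↑)

lowerTail-increasing : ∀ {a b} {σ : Fin (suc a) → Fin (suc b)} (σ↑ : StrictlyIncreasing σ) →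
                       StrictlyIncreasing (lowerTail σ↑)
lowerTail-increasing σ↑ = lower-increasing (tail-positive σ↑) (increasing-tail σ↑)

suc-lowerTail : ∀ {a b} {σ : Fin (suc a) → Fin (suc b)} (σ↑ : StrictlyIncreasing σ) i →
                suc (toℕ (lowerTail σ↑ i)) ≡ toℕ (σ (suc i))
suc-lowerTail {σ = σ} σ↑ = suc-lower (σ ∘ suc) (tail-positive σ↑)

no-increasing-map : ∀ m (σ : Fin (suc m) → Fin m) → StrictlyIncreasing σ → ⊥
no-increasing-map zero    σ σ↑ with σ zero
... | ()
no-increasing-map (suc m) σ σ↑ = no-increasing-map m (lowerTail σ↑) (lowerTail-increasing σ↑)

increasing-endo-id : ∀ k (σ : Fin k → Fin k) → StrictlyIncreasing σ → ∀ i → toℕ (σ i) ≡ toℕ i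
increasing-endo-id (suc k) σ σ↑ i with σ zero in σ0≡
... | suc _ = let σ>0 = positive-from-head σ↑ σ0≡ in
  ⊥-elim (no-increasing-map k (lower σ σ>0) (lower-increasing σ>0 σ↑))
... | zero with i
...   | zero  = cong toℕ σ0≡
...   | suc i = trans (sym (suc-lowerTail σ↑ i))
                      (cong suc (increasing-endo-id k (lowerTail σ↑) (lowerTail-increasing σ↑) i))

increasing⇒skip : ∀ k (σ : Fin k → Fin (suc k)) → StrictlyIncreasing σ →
                  Σ ℕ λ p → p ≤ k × (∀ i → toℕ (σ i) ≡ skip p (toℕ i))
increasing⇒skip zero    σ σ↑ = 0 , z≤n , λ ()
increasing⇒skip (suc k) σ σ↑ with σ zero in σ0≡
... | suc _ = let σ>0 = positive-from-head σ↑ σ0≡ in 0 , z≤n , λ i →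
  trans (sym (suc-lower σ σ>0 i)) (cong suc (increasing-endo-id (suc k) (lower σ σ>0) (lower-increasing σ>0 σ↑) i))
... | zero with increasing⇒skip k (lowerTail σ↑) (lowerTail-increasing σ↑)
...   | p , p≤k , σ′≡skip = suc p , s≤s p≤k , σ≡skip
  where
  σ≡skip : ∀ i → toℕ (σ i) ≡ skip (suc p) (toℕ i)
  σ≡skip zero    = cong toℕ σ0≡
  σ≡skip (suc i) = trans (sym (suc-lowerTail σ↑ i)) (trans (cong suc (σ′≡skip i)) (sym (skip-suc p (toℕ i))))

-- The tournament R_n on vertex indices

<ᵇ-true : ∀ {a b} → a < b → (a <ᵇ b) ≡ true
<ᵇ-true {a} {b} = dec-true (a <? b)

<ᵇ-false : ∀ {a b} → b ≤ a → (a <ᵇ b) ≡ false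
<ᵇ-false {a} {b} b≤a = dec-false (a <? b) (≤⇒≯ b≤a)

≡ᵇ-true : ∀ a → (a ≡ᵇ a) ≡ true
≡ᵇ-true a = dec-true (a ≟ a) refl

≡ᵇ-false : ∀ {a b} → a ≢ b → (a ≡ᵇ b) ≡ false
≡ᵇ-false {a} {b} = dec-false (a ≟ b)

StrictlyMonotone : (ℕ → ℕ) → Set
StrictlyMonotone f = ∀ {a b} → a < b → f a < f b

<ᵇ-monotone : ∀ {f} → StrictlyMonotone f → ∀ a b → (f a <ᵇ f b) ≡ (a <ᵇ b)
<ᵇ-monotone {f} f↑ a b with <-cmp a b
... | tri< a<b _ _    = trans (<ᵇ-true (f↑ a<b)) (sym (<ᵇ-true a<b))
... | tri≈ _ refl _   = trans (<ᵇ-false {f a} ≤-refl) (sym (<ᵇ-false {a} ≤-refl))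
... | tri> _ _ b<a    = trans (<ᵇ-false (<⇒≤ (f↑ b<a))) (sym (<ᵇ-false (<⇒≤ b<a)))

≡ᵇ-monotone : ∀ {f} → StrictlyMonotone f → ∀ a b → (f a ≡ᵇ f b) ≡ (a ≡ᵇ b)
≡ᵇ-monotone {f} f↑ a b with <-cmp a b
... | tri< a<b _ _    = trans (≡ᵇ-false (<⇒≢ (f↑ a<b))) (sym (≡ᵇ-false (<⇒≢ a<b)))
... | tri≈ _ refl _   = trans (≡ᵇ-true (f a)) (sym (≡ᵇ-true a))
... | tri> _ _ b<a    = trans (≡ᵇ-false (≢-sym (<⇒≢ (f↑ b<a)))) (sym (≡ᵇ-false (≢-sym (<⇒≢ b<a))))

skip-below : ∀ {p a} → a < p → skip p a ≡ a
skip-below a<p rewrite <ᵇ-true a<p = refl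

skip-above : ∀ {p a} → p ≤ a → skip p a ≡ suc a
skip-above p≤a rewrite <ᵇ-false p≤a = refl

skip-monotone : ∀ p → StrictlyMonotone (skip p)
skip-monotone p {a} {b} a<b with a <? p | b <? p
... | yes a<p | yes b<p rewrite skip-below a<p | skip-below b<p = a<b
... | yes a<p | no  b≮p rewrite skip-below a<p | skip-above (≮⇒≥ b≮p) = m<n⇒m<1+n a<b
... | no  a≮p | yes b<p = ⊥-elim (a≮p (<-trans a<b b<p))
... | no  a≮p | no  b≮p rewrite skip-above (≮⇒≥ a≮p) | skip-above (≮⇒≥ b≮p) = s≤s a<b

-- R n i j unfolds to Rℕ n (toℕ i) (toℕ j).
Rℕ : ℕ → ℕ → ℕ → Bool
Rℕ n a b = if a <ᵇ b then not ((a ≡ᵇ 0) ∧ (suc b ≡ᵇ n))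
                      else ((b ≡ᵇ 0) ∧ (suc a ≡ᵇ n) ∧ not (a ≡ᵇ b))

if-true-false : ∀ b → (if b then true else false) ≡ b
if-true-false true  = refl
if-true-false false = refl

R-skip-first : ∀ n a b → Rℕ (suc n) (skip 0 a) (skip 0 b) ≡ (a <ᵇ b)
R-skip-first n a b = if-true-false (a <ᵇ b)

R-skip-last : ∀ {k a b} → a < k → b < k → Rℕ (suc k) (skip k a) (skip k b) ≡ (a <ᵇ b)
R-skip-last {k} {a} {b} a<k b<k
  rewrite skip-below a<k | skip-below b<k | ≡ᵇ-false (<⇒≢ a<k) | ≡ᵇ-false (<⇒≢ b<k)
        | ∧-zeroʳ (a ≡ᵇ 0) | ∧-zeroʳ (b ≡ᵇ 0) = if-true-false (a <ᵇ b)

skip-≡ᵇ0 : ∀ {p} a → 0 < p → (skip p a ≡ᵇ 0) ≡ (a ≡ᵇ 0)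
skip-≡ᵇ0 zero    p>0 rewrite skip-below p>0 = refl
skip-≡ᵇ0 {p} (suc a) p>0 with suc a <ᵇ p
... | true  = refl
... | false = refl

skip-isLast : ∀ {p k} b → p < k → b < k → (suc (skip p b) ≡ᵇ suc k) ≡ (suc b ≡ᵇ k)
skip-isLast {p} b p<k b<k with b <? p
... | yes b<p rewrite skip-below b<p = trans (≡ᵇ-false (<⇒≢ b<k)) (sym (≡ᵇ-false (<⇒≢ (≤-<-trans b<p p<k))))
... | no  b≮p rewrite skip-above (≮⇒≥ b≮p) = refl

R-skip-middle : ∀ {p k} a b → 0 < p → p < k → a < k → b < k → Rℕ (suc k) (skip p a) (skip p b) ≡ Rℕ k a b
R-skip-middle {p} a b p>0 p<k a<k b<k
  rewrite <ᵇ-monotone (skip-monotone p) a b | ≡ᵇ-monotone (skip-monotone p) a b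
        | skip-≡ᵇ0 a p>0 | skip-≡ᵇ0 b p>0 | skip-isLast a p<k a<k | skip-isLast b p<k b<k = refl

swapℕ : ℕ → ℕ → ℕ
swapℕ q a = if a ≡ᵇ q then suc q else (if a ≡ᵇ suc q then q else a)

swapℕ-suc : ∀ q a → swapℕ (suc q) (suc a) ≡ suc (swapℕ q a)
swapℕ-suc q a with a ≡ᵇ q
... | true = refl
... | false with a ≡ᵇ suc q
...   | true  = refl
...   | false = refl

toℕ-swap : ∀ q {n} (i : Fin n) → suc (suc q) ≤ n → toℕ (swap q i) ≡ swapℕ q (toℕ i)
toℕ-swap zero    {suc (suc n)} zero          _ = refl
toℕ-swap zero    {suc (suc n)} (suc zero)    _ = refl
toℕ-swap zero    {suc (suc n)} (suc (suc i)) _ = refl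
toℕ-swap zero    {suc zero}    zero          (s≤s ())
toℕ-swap (suc q) {suc n}       zero          _ = refl
toℕ-swap (suc q) {suc n}       (suc i) (s≤s q+2≤n) =
  trans (cong suc (toℕ-swap q i q+2≤n)) (sym (swapℕ-suc q (toℕ i)))

-- The ranking 0, q, 1, 2, …, q − 1, q + 1, … : vertex q is moved into second place.
rotate : ℕ → ℕ → ℕ
rotate q a = if a ≡ᵇ q then 1 else (if a ≡ᵇ 0 then 0 else (if a <ᵇ q then suc a else a))

rotate-one : ∀ a → rotate 1 a ≡ a
rotate-one zero          = refl
rotate-one (suc zero)    = refl
rotate-one (suc (suc a)) = refl

<ᵇ-suc : ∀ {a q} → a ≢ q → (a <ᵇ suc q) ≡ (a <ᵇ q)
<ᵇ-suc {a} {q} a≢q with <-cmp a q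
... | tri< a<q _ _  = trans (<ᵇ-true (m<n⇒m<1+n a<q)) (sym (<ᵇ-true a<q))
... | tri≈ _ a≡q _  = ⊥-elim (a≢q a≡q)
... | tri> _ _ q<a  = trans (<ᵇ-false q<a) (sym (<ᵇ-false (<⇒≤ q<a)))

rotate-swap : ∀ q a → 1 ≤ q → rotate (suc q) (swapℕ q a) ≡ rotate q a
rotate-swap q a q≥1 with a ≟ q
... | yes refl rewrite ≡ᵇ-true a | ≡ᵇ-true a = refl
... | no a≢q with a ≟ suc q
...   | yes refl
  rewrite ≡ᵇ-false {suc q} {q} (≢-sym (<⇒≢ (n<1+n q))) | ≡ᵇ-true q | ≡ᵇ-false {q} {suc q} (<⇒≢ (n<1+n q))
        | ≡ᵇ-false {q} {0} (≢-sym (<⇒≢ q≥1)) | <ᵇ-true (n<1+n q) | <ᵇ-false {suc q} {q} (n≤1+n q) = refl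
...   | no a≢q+1 rewrite ≡ᵇ-false a≢q | ≡ᵇ-false a≢q+1 | ≡ᵇ-false a≢q+1 | <ᵇ-suc a≢q = refl

skewℕ : (ℕ → ℕ → Bool) → ℕ → ℕ → ℤ
skewℕ T a b = boolℤ (T a b) +ℤ - boolℤ (T b a)

rankedBy : (ℕ → ℕ) → ℕ → ℕ → Bool
rankedBy f a b = f a <ᵇ f b

signature : ℕ → ℕ → ℤ
signature L a = if a ≡ᵇ L then -1ℤ else 1ℤ

signature² : ∀ L a → signature L a *ℤ signature L a ≡ 1ℤ
signature² L a with a ≡ᵇ L
... | true  = refl
... | false = refl

data Position (L a : ℕ) : Set where
  first  : a ≡ 0 → Position L a
  last   : a ≡ L → Position L a
  middle : ∀ a′ → a ≡ suc a′ → suc a′ < L → Position L a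

position : ∀ L a → a ≤ L → Position L a
position L zero    _ = first refl
position L (suc a) a≤L with suc a ≟ L
... | yes a≡L = last a≡L
... | no  a≢L = middle a refl (≤∧≢⇒< a≤L a≢L)

-- Reversing every arc at the last vertex L of R_{L+1} yields the transitive tournament ranked by rotate L.
skew-rotate≡signature-skew-R : ∀ L a b → 2 ≤ L → a ≤ L → b ≤ L →
  skewℕ (rankedBy (rotate L)) a b ≡ signature L a *ℤ (signature L b *ℤ skewℕ (Rℕ (suc L)) a b)
skew-rotate≡signature-skew-R L@(suc (suc _)) a b (s≤s (s≤s z≤n)) a≤L b≤L with position L a a≤L | position L b b≤L
... | first refl | first refl = refl
... | first refl | last  refl rewrite ≡ᵇ-true L = refl
... | first refl | middle b′ refl b<L rewrite ≡ᵇ-false (<⇒≢ b<L) | <ᵇ-true b<L = refl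
... | last  refl | first refl rewrite ≡ᵇ-true L = refl
... | last  refl | last  refl rewrite ≡ᵇ-true L | <ᵇ-false {L} {L} ≤-refl = refl
... | last  refl | middle b′ refl b<L
  rewrite ≡ᵇ-true L | ≡ᵇ-false (<⇒≢ b<L) | <ᵇ-true b<L | <ᵇ-false (<⇒≤ b<L) = refl
... | middle a′ refl a<L | first refl rewrite ≡ᵇ-false (<⇒≢ a<L) | <ᵇ-true a<L = refl
... | middle a′ refl a<L | last  refl
  rewrite ≡ᵇ-true L | ≡ᵇ-false (<⇒≢ a<L) | <ᵇ-true a<L | <ᵇ-false (<⇒≤ a<L) = refl
... | middle a′ refl a<L | middle b′ refl b<L
  rewrite ≡ᵇ-false (<⇒≢ a<L) | ≡ᵇ-false (<⇒≢ b<L) | <ᵇ-true a<L | <ᵇ-true b<L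
        | if-true-false (a′ <ᵇ b′) | if-true-false (b′ <ᵇ a′) = sym (trans (ℤ.*-identityˡ _) (ℤ.*-identityˡ _))

R-into-first : ∀ {L a} → 2 ≤ L → a < L → Rℕ (suc L) a 0 ≡ false
R-into-first {a = zero}  (s≤s (s≤s z≤n)) _         = refl
R-into-first {a = suc a} (s≤s (s≤s z≤n)) (s≤s a<L) rewrite ≡ᵇ-false (<⇒≢ a<L) = refl

R-last-first : ∀ {L} → 1 ≤ L → Rℕ (suc L) L 0 ≡ true
R-last-first {suc L} _ rewrite ≡ᵇ-true L = refl

R-backward : ∀ {n r c} → c < r → Rℕ n r (suc c) ≡ false
R-backward c<r rewrite <ᵇ-false c<r = refl

R-forward-step : ∀ {L} r → 2 ≤ L → Rℕ (suc L) r (suc r) ≡ true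
R-forward-step zero    (s≤s (s≤s z≤n)) = refl
R-forward-step (suc r) (s≤s (s≤s z≤n)) rewrite <ᵇ-true (n<1+n r) = refl

-- Skew-adjacency matrices

skewMatrix : ∀ n → (ℕ → ℕ → Bool) → Matrix ℤ n
skewMatrix n T i j = skewℕ T (toℕ i) (toℕ j)

charPoly-skewMatrix-cong : ∀ n {T T′ : ℕ → ℕ → Bool} → (∀ a b → a < n → b < n → T a b ≡ T′ a b) →
                           charPoly (skewMatrix n T) ≋ charPoly (skewMatrix n T′)
charPoly-skewMatrix-cong n T≡T′ = charPoly-cong λ i j →
  cong₂ (λ x y → boolℤ x +ℤ - boolℤ y) (T≡T′ _ _ (toℕ<n i) (toℕ<n j)) (T≡T′ _ _ (toℕ<n j) (toℕ<n i))

charPoly-skewMatrix-restrict : ∀ {k n} (T : ℕ → ℕ → Bool) (σ : Fin k → Fin n) (f : ℕ → ℕ) →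
  (∀ i → toℕ (σ i) ≡ f (toℕ i)) →
  charPoly (principalSub (skewMatrix n T) σ) ≋ charPoly (skewMatrix k (λ a b → T (f a) (f b)))
charPoly-skewMatrix-restrict T σ f σ≡f = charPoly-cong λ i j → cong₂ (skewℕ T) (σ≡f i) (σ≡f j)

charPoly-skew-rotate : ∀ {k} q → 1 ≤ q → q < k →
                       charPoly (skewMatrix k (rankedBy (rotate q))) ≋ charPoly (skewMatrix k _<ᵇ_)
charPoly-skew-rotate {k} (suc zero) _ _ = charPoly-skewMatrix-cong k λ a b _ _ → cong₂ _<ᵇ_ (rotate-one a) (rotate-one b)
charPoly-skew-rotate {k} (suc (suc q)) _ q+2<k = begin
  charPoly (skewMatrix k (rankedBy (rotate (suc (suc q)))))
    ≈⟨ charPoly-conjugateSwap (suc q) (skewMatrix k (rankedBy (rotate (suc (suc q))))) q+2<k ⟨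
  charPoly (λ (i j : Fin k) → skewMatrix k (rankedBy (rotate (suc (suc q)))) (swap (suc q) i) (swap (suc q) j))
    ≈⟨ charPoly-cong swapped ⟩
  charPoly (skewMatrix k (rankedBy (rotate (suc q))))
    ≈⟨ charPoly-skew-rotate {k} (suc q) (s≤s z≤n) (<-trans (n<1+n (suc q)) q+2<k) ⟩
  charPoly (skewMatrix k _<ᵇ_) ∎
  where
  open ≋-Reasoning
  rotate-swap′ : ∀ (i : Fin k) → rotate (suc (suc q)) (toℕ (swap (suc q) i)) ≡ rotate (suc q) (toℕ i)
  rotate-swap′ i =
    trans (cong (rotate (suc (suc q))) (toℕ-swap (suc q) i q+2<k)) (rotate-swap (suc q) (toℕ i) (s≤s z≤n))
  swapped : ∀ i j → skewMatrix k (rankedBy (rotate (suc (suc q)))) (swap (suc q) i) (swap (suc q) j)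
                  ≡ skewMatrix k (rankedBy (rotate (suc q))) i j
  swapped i j = cong₂ (λ x y → boolℤ (x <ᵇ y) +ℤ - boolℤ (y <ᵇ x)) (rotate-swap′ i) (rotate-swap′ j)

charPoly-skewR≋transitive : ∀ L → 2 ≤ L →
                            charPoly (skewMatrix (suc L) (Rℕ (suc L))) ≋ charPoly (skewMatrix (suc L) _<ᵇ_)
charPoly-skewR≋transitive L L≥2 = begin
  charPoly (skewMatrix (suc L) (Rℕ (suc L)))
    ≈⟨ charPoly-conjugateSignature (skewMatrix (suc L) (Rℕ (suc L))) ε (λ i → signature² L (toℕ i)) ⟨
  charPoly (λ i j → ε i *ℤ (ε j *ℤ skewMatrix (suc L) (Rℕ (suc L)) i j))
    ≈⟨ charPoly-cong (λ i j → sym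
         (skew-rotate≡signature-skew-R L (toℕ i) (toℕ j) L≥2 (≤-pred (toℕ<n i)) (≤-pred (toℕ<n j)))) ⟩
  charPoly (skewMatrix (suc L) (rankedBy (rotate L)))
    ≈⟨ charPoly-skew-rotate L (≤-trans (s≤s z≤n) L≥2) (n<1+n L) ⟩
  charPoly (skewMatrix (suc L) _<ᵇ_) ∎
  where
  open ≋-Reasoning
  ε : Fin (suc L) → ℤ
  ε i = signature L (toℕ i)

charPoly-skewR-restricted : ∀ L → 2 ≤ L → (σ : Fin (suc L) → Fin (suc (suc L))) → StrictlyIncreasing σ →
  charPoly (principalSub (skewAdjacency (R (suc (suc L)))) σ) ≋ charPoly (skewMatrix (suc L) _<ᵇ_)
charPoly-skewR-restricted L L≥2 σ σ↑ with increasing⇒skip (suc L) σ σ↑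
... | p , p≤L+1 , σ≡skip =
  ≋-trans (charPoly-skewMatrix-restrict (Rℕ (suc (suc L))) σ (skip p) σ≡skip) (by-position p p≤L+1)
  where
  by-position : ∀ p → p ≤ suc L →
    charPoly (skewMatrix (suc L) (λ a b → Rℕ (suc (suc L)) (skip p a) (skip p b))) ≋ charPoly (skewMatrix (suc L) _<ᵇ_)
  by-position zero    _ = charPoly-skewMatrix-cong (suc L) λ a b _ _ → R-skip-first (suc L) a b
  by-position (suc p) p≤L+1 with suc p ≟ suc L
  ... | yes refl = charPoly-skewMatrix-cong (suc L) λ a b a<k b<k → R-skip-last a<k b<k
  ... | no  p≢L+1 = ≋-trans
    (charPoly-skewMatrix-cong (suc L) λ a b a<k b<k → R-skip-middle a b z<s (≤∧≢⇒< p≤L+1 p≢L+1) a<k b<k)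
    (charPoly-skewR≋transitive L L≥2)

skewR-spectrallyMonomorphic : ∀ L → 2 ≤ L → SpectrallyMonomorphic (suc L) (skewAdjacency (R (suc (suc L))))
skewR-spectrallyMonomorphic L L≥2 σ τ σ↑ τ↑ =
  coeff-≡ (≋-trans (charPoly-skewR-restricted L L≥2 σ σ↑) (≋-sym (charPoly-skewR-restricted L L≥2 τ τ↑)))

-- Adjacency matrices

skip-increasing : ∀ {k n} p (σ : Fin k → Fin n) → (∀ i → toℕ (σ i) ≡ skip p (toℕ i)) → StrictlyIncreasing σ
skip-increasing p σ σ≡skip i j i<j = subst₂ _<_ (sym (σ≡skip i)) (sym (σ≡skip j)) (skip-monotone p i<j)

toℕ-punchIn-last : ∀ {n} (i : Fin n) → toℕ (punchIn (fromℕ n) i) ≡ toℕ i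
toℕ-punchIn-last zero    = refl
toℕ-punchIn-last (suc i) = cong suc (toℕ-punchIn-last i)

∣signed∣ : ∀ j x → ∣ Detℤ.signed j x ∣ ≡ ∣ x ∣
∣signed∣ zero          x = refl
∣signed∣ (suc zero)    x = ℤ.∣-i∣≡∣i∣ x
∣signed∣ (suc (suc j)) x = ∣signed∣ j x

∣product∣≡1 : ∀ {n} (f : Fin n → ℤ) → (∀ i → ∣ f i ∣ ≡ 1) → ∣ Detℤ.product f ∣ ≡ 1
∣product∣≡1 {zero}  f _      = refl
∣product∣≡1 {suc n} f ∣f∣≡1 =
  trans (ℤ.abs-* (f zero) _) (cong₂ _*_ (∣f∣≡1 zero) (∣product∣≡1 (f ∘ suc) (∣f∣≡1 ∘ suc)))

-- Only the last vertex of R_{L+1} dominates the first, and the remaining minor is triangular.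
∣det-negAdjacency-R∣≡1 : ∀ L → 2 ≤ L → ∣ Detℤ.det (λ i j → - adjacency (R (suc L)) i j) ∣ ≡ 1
∣det-negAdjacency-R∣≡1 L L≥2 = begin
  ∣ Detℤ.det Z ∣
    ≡⟨ cong ∣_∣ (Detℤ.det-firstColumnLastOnly Z first-column) ⟩
  ∣ Detℤ.signed (toℕ (fromℕ L)) (Z (fromℕ L) zero *ℤ Detℤ.det W) ∣
    ≡⟨ ∣signed∣ (toℕ (fromℕ L)) _ ⟩
  ∣ Z (fromℕ L) zero *ℤ Detℤ.det W ∣
    ≡⟨ cong (λ x → ∣ x *ℤ Detℤ.det W ∣) corner ⟩
  ∣ -1ℤ *ℤ Detℤ.det W ∣
    ≡⟨ ℤ.abs-* -1ℤ (Detℤ.det W) ⟩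
  1 * ∣ Detℤ.det W ∣
    ≡⟨ *-identityˡ _ ⟩
  ∣ Detℤ.det W ∣
    ≡⟨ cong ∣_∣ (Detℤ.det-upperTriangular W below-diagonal) ⟩
  ∣ Detℤ.product (λ i → W i i) ∣
    ≡⟨ ∣product∣≡1 (λ i → W i i) (λ i → cong (∣_∣ ∘ -_ ∘ boolℤ) (diagonal i)) ⟩
  1 ∎
  where
  open ≡-Reasoning
  Z : Matrix ℤ (suc L)
  Z i j = - adjacency (R (suc L)) i j
  W : Matrix ℤ L
  W = Detℤ.firstColumnMinor Z (fromℕ L)
  first-column : ∀ i → Z (inject₁ i) zero ≡ + 0
  first-column i =
    cong (-_ ∘ boolℤ) (trans (cong (λ a → Rℕ (suc L) a 0) (toℕ-inject₁ i)) (R-into-first L≥2 (toℕ<n i)))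
  corner : Z (fromℕ L) zero ≡ -1ℤ
  corner =
    cong (-_ ∘ boolℤ) (trans (cong (λ a → Rℕ (suc L) a 0) (toℕ-fromℕ L)) (R-last-first (≤-trans (s≤s z≤n) L≥2)))
  W-entry : ∀ r c → W r c ≡ - boolℤ (Rℕ (suc L) (toℕ r) (suc (toℕ c)))
  W-entry r c = cong (λ a → - boolℤ (Rℕ (suc L) a (suc (toℕ c)))) (toℕ-punchIn-last r)
  below-diagonal : ∀ r c → toℕ c < toℕ r → W r c ≡ + 0
  below-diagonal r c c<r = trans (W-entry r c) (cong (-_ ∘ boolℤ) (R-backward {suc L} c<r))
  diagonal : ∀ i → Rℕ (suc L) (toℕ (punchIn (fromℕ L) i)) (suc (toℕ i)) ≡ true
  diagonal i = trans (cong (λ a → Rℕ (suc L) a (suc (toℕ i))) (toℕ-punchIn-last i)) (R-forward-step (toℕ i) L≥2)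

adjacencyR-not-spectrallyMonomorphic : ∀ L → 2 ≤ L → ¬ SpectrallyMonomorphic (suc L) (adjacency (R (suc (suc L))))
adjacencyR-not-spectrallyMonomorphic L L≥2 monomorphic = 0≢1 (begin
  0                                                           ≡⟨ cong ∣_∣ constant-term-without-first ⟨
  ∣ coeff (charPoly (principalSub A suc)) 0 ∣                 ≡⟨ cong ∣_∣ (monomorphic suc τ suc-increasing τ-increasing 0) ⟩
  ∣ coeff (charPoly (principalSub A τ)) 0 ∣                   ≡⟨ cong ∣_∣ constant-term-without-second ⟩
  ∣ Detℤ.det (λ i j → - adjacency (R (suc L)) i j) ∣          ≡⟨ ∣det-negAdjacency-R∣≡1 L L≥2 ⟩
  1                                                           ∎)
  where
  open ≡-Reasoning
  A : Matrix ℤ (suc (suc L))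
  A = adjacency (R (suc (suc L)))
  τ : Fin (suc L) → Fin (suc (suc L))
  τ = punchIn (suc zero)
  τ≡skip : ∀ i → toℕ (τ i) ≡ skip 1 (toℕ i)
  τ≡skip zero    = refl
  τ≡skip (suc i) = refl
  suc-increasing : StrictlyIncreasing (suc {suc L})
  suc-increasing = skip-increasing 0 suc (λ _ → refl)
  τ-increasing : StrictlyIncreasing τ
  τ-increasing = skip-increasing 1 τ τ≡skip
  -- the first remaining vertex v₂ is dominated only by the deleted v₁
  constant-term-without-first : coeff (charPoly (principalSub A suc)) 0 ≡ + 0
  constant-term-without-first = trans (coeff₀-charPoly (principalSub A suc))
    (Detℤ.det-zeroFirstColumn (λ i j → - principalSub A suc i j) (λ _ → refl))
  constant-term-without-second : coeff (charPoly (principalSub A τ)) 0 ≡ Detℤ.det (λ i j → - adjacency (R (suc L)) i j)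
  constant-term-without-second = trans
    (coeff-≡ (charPoly-cong λ i j → cong boolℤ (trans (cong₂ (Rℕ (suc (suc L))) (τ≡skip i) (τ≡skip j))
      (R-skip-middle (toℕ i) (toℕ j) z<s (≤-trans (s≤s (s≤s z≤n)) (s≤s L≥2)) (toℕ<n i) (toℕ<n j)))) 0)
    (coeff₀-charPoly (adjacency (R (suc L))))
  0≢1 : ¬ (0 ≡ 1)
  0≢1 ()

proposition5p4 : (n : ℕ) → 4 ≤ n →
    SpectrallyMonomorphic (n ∸ 1) (skewAdjacency (R n)) × ¬ SpectrallyMonomorphic (n ∸ 1) (adjacency (R n))
proposition5p4 (suc (suc L)) (s≤s (s≤s L≥2)) =
  skewR-spectrallyMonomorphic L L≥2 , adjacencyR-not-spectrallyMonomorphic L L≥2
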